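{- Let $H$ be a graph of order at least $2$ and let $k$ be a positive integer with $k\le\mathcal{C}(K_1+H)$. The following are equivalent: (i) there exists a $k$-adjacency basis $A$ of $H$ such that $|A\setminus N_H(y)|\ge k$ for all $y\in V(H)$; (ii) $\operatorname{adim}_k(K_1+H)=\operatorname{adim}_k(H)$.
   Context: All graphs are finite and simple; $N_H(y)$ is the open neighbourhood of $y$ in $H$. The join $G+H$ of vertex-disjoint graphs has vertex set $V(G)\cup V(H)$ and edges $E(G)\cup E(H)\cup\{uv:u\in V(G),v\in V(H)\}$; $K_1$ is the one-vertex graph. For a graph $G=(V,E)$, $d_{G,2}(x,y)=\min\{d_G(x,y),2\}$ with $d_G$ the shortest-path distance ($\infty$ between different components). For distinct $x,y$, $\mathcal{C}_G(x,y)=\{z\in V: d_{G,2}(x,z)\ne d_{G,2}(y,z)\}$, $\mathcal{C}(G)=\min_{x\ne y}|\mathcal{C}_G(x,y)|$. A set $S\subseteq V$ is a $k$-adjacency generator if $|S\cap\mathcal{C}_G(x,y)|\ge k$ for all distinct $x,y$; a minimum one is a $k$-adjacency basis, of size $\operatorname{adim}_k(G)$. -}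

module Defs where

open import Data.Nat using (ℕ; zero; suc; _≤_)
open import Data.Bool using (Bool; true; false; if_then_else_; not)
open import Data.Fin using (Fin; zero; suc)
open import Data.Fin.Properties using (_≟_)
open import Data.Fin.Subset using (Subset; _∩_; _─_; ∣_∣)
open import Data.Vec using (tabulate)
open import Data.Product using (Σ; _×_; _,_)
open import Relation.Nullary using (¬_; does)
open import Relation.Binary.PropositionalEquality using (_≡_)

record Graph : Set where
  field
    order  : ℕ
    adj    : Fin order → Fin order → Bool
    sym    : ∀ x y → adj x y ≡ adj y x
    irrefl : ∀ x → adj x x ≡ false
open Graph public

N : (G : Graph) → Fin (order G) → Subset (order G)
N G y = tabulate (λ z → adj G y z)

-- d_{G,2}(x,z) = min{d_G(x,z),2}: 0 if x = z, 1 if adjacent, 2 otherwise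
d2 : (G : Graph) → Fin (order G) → Fin (order G) → ℕ
d2 G x z = if does (x ≟ z) then 0 else (if adj G x z then 1 else 2)

C : (G : Graph) → Fin (order G) → Fin (order G) → Subset (order G)
C G x y = tabulate (λ z → not (does (Data.Nat._≟_ (d2 G x z) (d2 G y z))))
  where import Data.Nat

-- k ≤ 𝒞(G) = min_{x≠y} |C_G(x,y)|  (unfolded: k is at most every |C_G(x,y)|)
_≤𝒞_ : ℕ → Graph → Set
k ≤𝒞 G = ∀ (x y : Fin (order G)) → ¬ (x ≡ y) → k ≤ ∣ C G x y ∣

IsKAdjGen : ℕ → (G : Graph) → Subset (order G) → Set
IsKAdjGen k G S = ∀ (x y : Fin (order G)) → ¬ (x ≡ y) → k ≤ ∣ S ∩ C G x y ∣

IsKAdjBasis : ℕ → (G : Graph) → Subset (order G) → Set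
IsKAdjBasis k G S =
  IsKAdjGen k G S × (∀ (S' : Subset (order G)) → IsKAdjGen k G S' → ∣ S ∣ ≤ ∣ S' ∣)

IsAdim : ℕ → Graph → ℕ → Set
IsAdim k G m = Σ (Subset (order G)) (λ S → IsKAdjBasis k G S × ∣ S ∣ ≡ m)

-- the join K_1 + H ; vertex zero is the K_1 vertex, suc i is vertex i of H
joinK1-adj : (H : Graph) → Fin (suc (order H)) → Fin (suc (order H)) → Bool
joinK1-adj H zero    zero    = false
joinK1-adj H zero    (suc j) = true
joinK1-adj H (suc i) zero    = true
joinK1-adj H (suc i) (suc j) = adj H i j

joinK1-sym : (H : Graph) → ∀ x y → joinK1-adj H x y ≡ joinK1-adj H y x
joinK1-sym H zero    zero    = Relation.Binary.PropositionalEquality.refl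
joinK1-sym H zero    (suc j) = Relation.Binary.PropositionalEquality.refl
joinK1-sym H (suc i) zero    = Relation.Binary.PropositionalEquality.refl
joinK1-sym H (suc i) (suc j) = sym H i j

joinK1-irrefl : (H : Graph) → ∀ x → joinK1-adj H x x ≡ false
joinK1-irrefl H zero    = Relation.Binary.PropositionalEquality.refl
joinK1-irrefl H (suc i) = irrefl H i

K1+_ : Graph → Graph
K1+ H = record
  { order  = suc (order H)
  ; adj    = joinK1-adj H
  ; sym    = joinK1-sym H
  ; irrefl = joinK1-irrefl H
  }

-- Each vertex of H is adjacent to the apex of K₁ + H, so two vertices of H are
-- distinguished in K₁ + H exactly by the vertices distinguishing them in H, while the
-- apex and a vertex y of H are distinguished by the apex and by V(H) ∖ N_H(y). Hence a
-- set avoiding the apex is a k-adjacency generator of K₁ + H iff it is one of H that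
-- meets every V(H) ∖ N_H(y) in at least k vertices. A basis of K₁ + H of size
-- adim_k(H) must avoid the apex, since its trace on H is already a generator of H.
module Submission where

open import Defs hiding (sym)
open import Data.Nat using (ℕ; _≤_; _<_; _≥_; s≤s)
import Data.Nat as ℕ
open import Data.Nat.Properties using (≤-trans; <-irrefl)
open import Data.Bool using (true; false; not)
open import Data.Fin using (zero; suc)
import Data.Fin.Properties as Fin
open import Data.Fin.Subset using (Subset; inside; outside; ∁; _∩_; _─_; ∣_∣)
open import Data.Fin.Subset.Properties using (∣p∣≤∣x∷p∣)
open import Data.Vec using ([]; _∷_; tabulate)
open import Data.Vec.Properties using (tabulate-cong; tabulate-∘)
open import Data.Empty using (⊥-elim)
open import Data.Product using (Σ; _×_; _,_)
open import Function using (_∘_)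
open import Function.Bundles using (_⇔_; mk⇔; Equivalence)
open import Relation.Nullary using (does; yes; no)
open import Relation.Nullary.Decidable using (does-⇔)
open import Relation.Binary.PropositionalEquality
  using (_≡_; refl; sym; trans; cong; cong₂; subst; module ≡-Reasoning)

p∩∁q≡p─q : ∀ {n} (p q : Subset n) → p ∩ ∁ q ≡ p ─ q
p∩∁q≡p─q []            []            = refl
p∩∁q≡p─q (outside ∷ p) (outside ∷ q) = cong (outside ∷_) (p∩∁q≡p─q p q)
p∩∁q≡p─q (outside ∷ p) (inside  ∷ q) = cong (outside ∷_) (p∩∁q≡p─q p q)
p∩∁q≡p─q (inside  ∷ p) (outside ∷ q) = cong (inside  ∷_) (p∩∁q≡p─q p q)
p∩∁q≡p─q (inside  ∷ p) (inside  ∷ q) = cong (outside ∷_) (p∩∁q≡p─q p q)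

∣x∷p∩outside∷q∣≡∣p∩q∣ : ∀ {n} x (p q : Subset n) → ∣ (x ∷ p) ∩ (outside ∷ q) ∣ ≡ ∣ p ∩ q ∣
∣x∷p∩outside∷q∣≡∣p∩q∣ outside p q = refl
∣x∷p∩outside∷q∣≡∣p∩q∣ inside  p q = refl

module _ (G : Graph) where

  C-sym : ∀ x y → C G x y ≡ C G y x
  C-sym x y = tabulate-cong λ z →
    cong not (does-⇔ (mk⇔ sym sym) (d2 G x z ℕ.≟ d2 G y z) (d2 G y z ℕ.≟ d2 G x z))

  basis-of-same-size : ∀ {k} B S → IsKAdjBasis k G B → IsKAdjGen k G S → ∣ S ∣ ≡ ∣ B ∣ →
    IsKAdjBasis k G S
  basis-of-same-size B S (_ , minimal) gen S≡B =
    gen , λ S' gen' → subst (_≤ ∣ S' ∣) (sym S≡B) (minimal S' gen')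

  does-1≟d2≡adj : ∀ x z → does (1 ℕ.≟ d2 G x z) ≡ adj G x z
  does-1≟d2≡adj x z with x Fin.≟ z
  ... | yes refl = sym (irrefl G x)
  ... | no _ with adj G x z
  ...   | false = refl
  ...   | true  = refl

module _ (H : Graph) where

  d2-K1+-suc : ∀ x z → d2 (K1+ H) (suc x) (suc z) ≡ d2 H x z
  d2-K1+-suc x z with x Fin.≟ z
  ... | yes _ = refl
  ... | no  _ = refl

  C-K1+-suc : ∀ x y → C (K1+ H) (suc x) (suc y) ≡ outside ∷ C H x y
  C-K1+-suc x y = cong (outside ∷_) (tabulate-cong λ z →
    cong₂ (λ a b → not (does (a ℕ.≟ b))) (d2-K1+-suc x z) (d2-K1+-suc y z))

  C-K1+-apex : ∀ y → C (K1+ H) zero (suc y) ≡ inside ∷ ∁ (N H y)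
  C-K1+-apex y = cong (inside ∷_) (begin
    tabulate (λ z → not (does (1 ℕ.≟ d2 (K1+ H) (suc y) (suc z))))
      ≡⟨ tabulate-cong (λ z → cong (λ d → not (does (1 ℕ.≟ d))) (d2-K1+-suc y z)) ⟩
    tabulate (λ z → not (does (1 ℕ.≟ d2 H y z)))
      ≡⟨ tabulate-cong (cong not ∘ does-1≟d2≡adj H y) ⟩
    tabulate (not ∘ adj H y)
      ≡⟨ tabulate-∘ not (adj H y) ⟩
    ∁ (N H y) ∎)
    where open ≡-Reasoning

module _ (H : Graph) (k : ℕ) where

  ∣A∩C-K1+-suc∣ : ∀ x A u v → ∣ (x ∷ A) ∩ C (K1+ H) (suc u) (suc v) ∣ ≡ ∣ A ∩ C H u v ∣
  ∣A∩C-K1+-suc∣ x A u v =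
    trans (cong (λ X → ∣ (x ∷ A) ∩ X ∣) (C-K1+-suc H u v)) (∣x∷p∩outside∷q∣≡∣p∩q∣ x A (C H u v))

  ∣A∩C-K1+-apex∣ : ∀ A y → ∣ (outside ∷ A) ∩ C (K1+ H) zero (suc y) ∣ ≡ ∣ A ─ N H y ∣
  ∣A∩C-K1+-apex∣ A y = cong ∣_∣ (begin
    (outside ∷ A) ∩ C (K1+ H) zero (suc y) ≡⟨ cong ((outside ∷ A) ∩_) (C-K1+-apex H y) ⟩
    outside ∷ A ∩ ∁ (N H y)                 ≡⟨ cong (outside ∷_) (p∩∁q≡p─q A (N H y)) ⟩
    outside ∷ (A ─ N H y)                   ∎)
    where open ≡-Reasoning

  IsKAdjGen-K1+⇒IsKAdjGen : ∀ x A → IsKAdjGen k (K1+ H) (x ∷ A) → IsKAdjGen k H A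
  IsKAdjGen-K1+⇒IsKAdjGen x A gen u v u≢v =
    subst (k ≤_) (∣A∩C-K1+-suc∣ x A u v) (gen (suc u) (suc v) (u≢v ∘ Fin.suc-injective))

  apex-free-IsKAdjGen-K1+⇔ : ∀ A →
    IsKAdjGen k (K1+ H) (outside ∷ A) ⇔ (IsKAdjGen k H A × (∀ y → ∣ A ─ N H y ∣ ≥ k))
  apex-free-IsKAdjGen-K1+⇔ A = mk⇔
    (λ gen → IsKAdjGen-K1+⇒IsKAdjGen outside A gen ,
             λ y → subst (k ≤_) (∣A∩C-K1+-apex∣ A y) (gen zero (suc y) λ ()))
    extend
    where
    extend : IsKAdjGen k H A × (∀ y → ∣ A ─ N H y ∣ ≥ k) → IsKAdjGen k (K1+ H) (outside ∷ A)
    extend _         zero    zero    z≢z = ⊥-elim (z≢z refl)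
    extend (_ , far) zero    (suc y) _   = subst (k ≤_) (sym (∣A∩C-K1+-apex∣ A y)) (far y)
    extend (_ , far) (suc y) zero    _   =
      subst (k ≤_) (sym (trans (cong (λ X → ∣ (outside ∷ A) ∩ X ∣) (C-sym (K1+ H) (suc y) zero))
                               (∣A∩C-K1+-apex∣ A y)))
            (far y)
    extend (gen , _) (suc u) (suc v) u≢v =
      subst (k ≤_) (sym (∣A∩C-K1+-suc∣ outside A u v)) (gen u v (u≢v ∘ cong suc))

  apex-free-IsKAdjBasis-K1+ : ∀ A → IsKAdjBasis k H A → (∀ y → ∣ A ─ N H y ∣ ≥ k) →
    IsKAdjBasis k (K1+ H) (outside ∷ A)
  apex-free-IsKAdjBasis-K1+ A (gen , minimal) far =
    Equivalence.from (apex-free-IsKAdjGen-K1+⇔ A) (gen , far) ,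
    λ { (x ∷ S) gen' → ≤-trans (minimal S (IsKAdjGen-K1+⇒IsKAdjGen x S gen')) (∣p∣≤∣x∷p∣ x S) }

  IsKAdjBasis<apex∈IsKAdjGen-K1+ : ∀ B A → IsKAdjBasis k H B →
    IsKAdjGen k (K1+ H) (inside ∷ A) → ∣ B ∣ < ∣ inside ∷ A ∣
  IsKAdjBasis<apex∈IsKAdjGen-K1+ B A (_ , minimal) gen =
    s≤s (minimal A (IsKAdjGen-K1+⇒IsKAdjGen inside A gen))

  FarBasis : Set
  FarBasis = Σ (Subset (order H)) (λ A → IsKAdjBasis k H A × (∀ y → ∣ A ─ N H y ∣ ≥ k))

  SameAdim : Set
  SameAdim = Σ ℕ (λ m → IsAdim k (K1+ H) m × IsAdim k H m)

  FarBasis⇒SameAdim : FarBasis → SameAdim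
  FarBasis⇒SameAdim (A , basis , far) =
    ∣ A ∣ , (outside ∷ A , apex-free-IsKAdjBasis-K1+ A basis far , refl) , (A , basis , refl)

  SameAdim⇒FarBasis : SameAdim → FarBasis
  SameAdim⇒FarBasis (_ , (inside ∷ A , (gen , _) , refl) , (B , basisB , B≡S)) =
    ⊥-elim (<-irrefl B≡S (IsKAdjBasis<apex∈IsKAdjGen-K1+ B A basisB gen))
  SameAdim⇒FarBasis (_ , (outside ∷ A , (gen , _) , refl) , (B , basisB , B≡S)) =
    let genH , far = Equivalence.to (apex-free-IsKAdjGen-K1+⇔ A) gen
    in A , basis-of-same-size H B A basisB genH (sym B≡S) , far

-- The hypotheses on the order of H and on k only guarantee that k-adjacency bases
-- exist; both sides of the equivalence already provide the bases they talk about.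
theorem26 : (H : Graph) → 2 ≤ order H → (k : ℕ) → 1 ≤ k → k ≤𝒞 (K1+ H) →
    (Σ (Subset (order H)) (λ A → IsKAdjBasis k H A × (∀ y → ∣ A ─ N H y ∣ ≥ k)))
    ⇔ (Σ ℕ (λ m → IsAdim k (K1+ H) m × IsAdim k H m))
theorem26 H _ k _ _ = mk⇔ (FarBasis⇒SameAdim H k) (SameAdim⇒FarBasis H k)
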